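{- Let $\mathbf{C}$ be a presheaf topos, let $c,b\in\mathrm{AC}(X)$, and let $\mathcal{C}$ be a root shifter from $X$ to $Y$ that is defined on both $c$ and $b$. If $m=(o,(v_1,m_1)\cdots(v_{|b|},m_{|b|}))$ is a forward-shift (resp. backward-shift) condition morphism from $c$ to $b$, then the same tuple $m$ is also a forward-shift (resp. backward-shift) condition morphism from $\mathcal{C}(c)$ to $\mathcal{C}(b)$.
   Context: Composition is written in diagrammatic order: $f;g$ is $f$ followed by $g$. Ab-conditions. $\mathrm{AC}(R)$ and $\mathrm{AB}(R)$ are the smallest sets with: - $(R,p_1\cdots p_w)\in\mathrm{AC}(R)$ for $w\ge0$ and $p_i\in\mathrm{AB}(R)$; - $(a,c')\in\mathrm{AB}(R)$ for $a:R\to P$ and $c'\in\mathrm{AC}(P)$. We write $|c|=w$ and $p^c_i=(a^c_i,c_i)$, with $a^c_i:R\to P^c_i$. Source shifters. A source shifter from $X$ to $Y$ is a family $\mathcal{S}_Z:\mathbf{C}(X,Z)\to\mathbf{C}(Y,Z)$ with $\mathcal{S}(a;t)=\mathcal{S}(a);t$. - Forward source shifter for $v:A\to B$: a source shifter from $A$ to $B$ with $v;g=a;h\Rightarrow g=\mathcal{S}(a);h$ for all $a:A\to C$, $g:B\to G$, $h:C\to G$. - Backward source shifter for $v$: a source shifter from $B$ to $A$ with $v;g=\mathcal{S}(a);h\Rightarrow g=a;h$ for all $a:B\to C$, $g:B\to G$, $h:C\to G$. Root shifters. $\bar{\mathcal{S}}(c)=(Y,(\mathcal{S}(a^c_1),c_1)\cdots(\mathcal{S}(a^c_{|c|}),c_{|c|}))$.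 The trivial $\mathcal{I}_{X,Y}$ is defined only on zero-width conditions, by $(X,\epsilon)\mapsto(Y,\epsilon)$. - A root shifter from $X$ to $Y$ is $\bar{\mathcal{S}}$ for a source shifter $\mathcal{S}$ from $X$ to $Y$, or $\mathcal{I}_{X,Y}$. - A forward root shifter for $v:A\to B$ is $\bar{\mathcal{F}}$ ($\mathcal{F}$ forward for $v$) or $\mathcal{I}_{A,B}$. - A backward root shifter for $v$ is $\bar{\mathcal{B}}$ ($\mathcal{B}$ backward for $v$) or $\mathcal{I}_{B,A}$. Morphisms. For $c,b\in\mathrm{AC}(R)$, a forward-shift (resp. backward-shift) condition morphism $m:c\to b$ is a tuple $(o,(v_1,m_1)\cdots(v_{|b|},m_{|b|}))$, defined inductively on depth, where: - $o:[1,|b|]\to[1,|c|]$; - $v_i:P^c_{o(i)}\to P^b_i$ with $a^c_{o(i)};v_i=a^b_i$; - forward case: for each $i$ there is a forward root shifter $\mathcal{F}_i$ for $v_i$, defined on $c_{o(i)}$, with $m_i$ a forward-shift morphism $b_i\to\mathcal{F}_i(c_{o(i)})$; - backward case: for each $i$ there is a backward root shifter $\mathcal{B}_i$ for $v_i$, defined on $b_i$, with $m_i$ a backward-shift morphism $\mathcal{B}_i(b_i)\to c_{o(i)}$. -}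

module Defs where

open import Level using (Level)
open import Data.Nat using (ℕ; zero; suc)
open import Data.Fin using (Fin; toℕ)
open import Data.Unit using (⊤)
open import Data.Product using (Σ; _,_)
open import Relation.Binary.PropositionalEquality using (_≡_)

-- Small categories (hom equality is propositional equality).
-- Composition is written in diagrammatic order: f ⨾ g is f followed by g.

record SmallCategory : Set₁ where
  infixr 9 _⨾_
  field
    Ob    : Set
    Hom   : Ob → Ob → Set
    id    : ∀ {d} → Hom d d
    _⨾_   : ∀ {d e f} → Hom d e → Hom e f → Hom d f
    idˡ   : ∀ {d e} (f : Hom d e) → id ⨾ f ≡ f
    idʳ   : ∀ {d e} (f : Hom d e) → f ⨾ id ≡ f
    assoc : ∀ {d e f g} (x : Hom d e) (y : Hom e f) (z : Hom f g) →
            (x ⨾ y) ⨾ z ≡ x ⨾ (y ⨾ z)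

module Presheaves (D : SmallCategory) where
  open SmallCategory D renaming (Hom to HomD; id to idD; _⨾_ to _⨾D_)

  record Presheaf : Set₁ where
    field
      F₀   : Ob → Set
      F₁   : ∀ {d e} → HomD d e → F₀ e → F₀ d
      F-id : ∀ {d} (x : F₀ d) → F₁ (idD {d}) x ≡ x
      F-⨾  : ∀ {d e f} (g : HomD d e) (h : HomD e f) (x : F₀ f) →
             F₁ (g ⨾D h) x ≡ F₁ g (F₁ h x)
  open Presheaf public

  record _⇒_ (P Q : Presheaf) : Set where
    field
      η   : ∀ d → F₀ P d → F₀ Q d
      nat : ∀ {d e} (g : HomD d e) (x : F₀ P e) →
            η d (F₁ P g x) ≡ F₁ Q g (η e x)
  open _⇒_ public

  infix 4 _≈_
  _≈_ : ∀ {P Q} → P ⇒ Q → P ⇒ Q → Set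
  α ≈ β = ∀ d x → η α d x ≡ η β d x

  infixr 9 _⨾_
  _⨾_ : ∀ {P Q R} → P ⇒ Q → Q ⇒ R → P ⇒ R
  η (α ⨾ β) d x = η β d (η α d x)
  nat (_⨾_ {P} {Q} {R} α β) {d} {e} g x
    rewrite nat α g x = nat β g (η α e x)

  -- Ab-conditions AC(R) and branches AB(R).
  -- (R, p₁ ⋯ p_w) is  cond w p  with  p : Fin w → AB R.

  mutual
    data AC (R : Presheaf) : Set₁ where
      cond : (w : ℕ) → (Fin w → AB R) → AC R

    data AB (R : Presheaf) : Set₁ where
      br : {P : Presheaf} → R ⇒ P → AC P → AB R

  width : ∀ {R} → AC R → ℕ
  width (cond w _) = w

  branch : ∀ {R} (c : AC R) → Fin (width c) → AB R
  branch (cond _ p) i = p i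

  tgt : ∀ {R} → AB R → Presheaf
  tgt (br {P} _ _) = P

  arrOf : ∀ {R} (p : AB R) → R ⇒ tgt p
  arrOf (br a _) = a

  subOf : ∀ {R} (p : AB R) → AC (tgt p)
  subOf (br _ c) = c

  objAt : ∀ {R} (c : AC R) → Fin (width c) → Presheaf
  objAt c i = tgt (branch c i)

  arrAt : ∀ {R} (c : AC R) (i : Fin (width c)) → R ⇒ objAt c i
  arrAt c i = arrOf (branch c i)

  subAt : ∀ {R} (c : AC R) (i : Fin (width c)) → AC (objAt c i)
  subAt c i = subOf (branch c i)

  -- Source shifters.  Since hom-sets of C carry the extensional
  -- equality ≈, a family of functions on hom-sets is required to
  -- respect ≈.

  record SourceShifter (X Y : Presheaf) : Set₁ where
    field
      shift      : ∀ {Z} → X ⇒ Z → Y ⇒ Z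
      shift-cong : ∀ {Z} {a a′ : X ⇒ Z} → a ≈ a′ → shift a ≈ shift a′
      shift-⨾    : ∀ {Z W} (a : X ⇒ Z) (t : Z ⇒ W) →
                   shift (a ⨾ t) ≈ shift a ⨾ t
  open SourceShifter public

  IsForward : ∀ {A B} → A ⇒ B → SourceShifter A B → Set₁
  IsForward {A} {B} v S =
    ∀ {C G} (a : A ⇒ C) (g : B ⇒ G) (h : C ⇒ G) →
    v ⨾ g ≈ a ⨾ h → g ≈ shift S a ⨾ h

  IsBackward : ∀ {A B} → A ⇒ B → SourceShifter B A → Set₁
  IsBackward {A} {B} v S =
    ∀ {C G} (a : B ⇒ C) (g : B ⇒ G) (h : C ⇒ G) →
    v ⨾ g ≈ shift S a ⨾ h → g ≈ a ⨾ h

  data RootShifter (X Y : Presheaf) : Set₁ where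
    rshift : SourceShifter X Y → RootShifter X Y
    rtriv  : RootShifter X Y

  DefinedOn : ∀ {X Y} → RootShifter X Y → AC X → Set
  DefinedOn (rshift _) c = ⊤
  DefinedOn rtriv      c = width c ≡ 0

  shiftBr : ∀ {X Y} → SourceShifter X Y → AB X → AB Y
  shiftBr S p = br {P = tgt p} (shift S (arrOf p)) (subOf p)

  applyR : ∀ {X Y} (𝒞 : RootShifter X Y) (c : AC X) → DefinedOn 𝒞 c → AC Y
  applyR (rshift S) c _ = cond (width c) (λ i → shiftBr S (branch c i))
  applyR rtriv      c _ = cond 0 (λ ())

  data FwdRoot {A B : Presheaf} (v : A ⇒ B) : Set₁ where
    fwd   : (S : SourceShifter A B) → IsForward v S → FwdRoot v
    ftriv : FwdRoot v

  fwdRoot : ∀ {A B} {v : A ⇒ B} → FwdRoot v → RootShifter A B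
  fwdRoot (fwd S _) = rshift S
  fwdRoot ftriv     = rtriv

  data BwdRoot {A B : Presheaf} (v : A ⇒ B) : Set₁ where
    bwd   : (S : SourceShifter B A) → IsBackward v S → BwdRoot v
    btriv : BwdRoot v

  bwdRoot : ∀ {A B} {v : A ⇒ B} → BwdRoot v → RootShifter B A
  bwdRoot (bwd S _) = rshift S
  bwdRoot btriv     = rtriv

  -- A value of FMor c b packages the tuple
  -- (o, (v₁,m₁)⋯(v_|b|,m_|b|)) together with the witnesses (root
  -- shifters, definedness, commutation) that make it a forward-shift
  -- (resp. backward-shift) condition morphism c → b.

  data FMor {R : Presheaf} (c b : AC R) : Set₁ where
    fmor : (o  : Fin (width b) → Fin (width c))
         → (v  : (i : Fin (width b)) → objAt c (o i) ⇒ objAt b i)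
         → (comm : ∀ i → arrAt c (o i) ⨾ v i ≈ arrAt b i)
         → (F  : (i : Fin (width b)) → FwdRoot (v i))
         → (def : ∀ i → DefinedOn (fwdRoot (F i)) (subAt c (o i)))
         → (m  : ∀ i → FMor (subAt b i)
                            (applyR (fwdRoot (F i)) (subAt c (o i)) (def i)))
         → FMor c b

  data BMor {R : Presheaf} (c b : AC R) : Set₁ where
    bmor : (o  : Fin (width b) → Fin (width c))
         → (v  : (i : Fin (width b)) → objAt c (o i) ⇒ objAt b i)
         → (comm : ∀ i → arrAt c (o i) ⨾ v i ≈ arrAt b i)
         → (B  : (i : Fin (width b)) → BwdRoot (v i))
         → (def : ∀ i → DefinedOn (bwdRoot (B i)) (subAt b i))
         → (m  : ∀ i → BMor (applyR (bwdRoot (B i)) (subAt b i) (def i))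
                            (subAt c (o i)))
         → BMor c b

  -- The bare tuple (o, (v₁,m₁)⋯(v_n,m_n)) underlying a morphism,
  -- forgetting the witnesses.

  Arrow : Set₁
  Arrow = Σ Presheaf λ A → Σ Presheaf λ B → A ⇒ B

  data Tuple : Set₁ where
    tuple : (n : ℕ) → (Fin n → ℕ) → (Fin n → Arrow) → (Fin n → Tuple) → Tuple

  tupleF : ∀ {R} {c b : AC R} → FMor c b → Tuple
  tupleF {b = b} (fmor o v _ _ _ m) =
    tuple (width b) (λ i → toℕ (o i)) (λ i → _ , _ , v i) (λ i → tupleF (m i))

  tupleB : ∀ {R} {c b : AC R} → BMor c b → Tuple
  tupleB {b = b} (bmor o v _ _ _ m) =
    tuple (width b) (λ i → toℕ (o i)) (λ i → _ , _ , v i) (λ i → tupleB (m i))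

  -- "the same tuple": equal length and componentwise equal entries
  -- (pointwise, to avoid needing function extensionality).
  infix 4 _≐_
  data _≐_ : Tuple → Tuple → Set₁ where
    same : ∀ {n o o′ v v′ m m′}
         → (∀ i → o i ≡ o′ i)
         → (∀ i → v i ≡ v′ i)
         → (∀ i → m i ≐ m′ i)
         → tuple n o v m ≐ tuple n o′ v′ m′

{-# OPTIONS --safe #-}
-- A source shifter S satisfies S(a ⨾ t) = S(a) ⨾ t, so it maps each commuting
-- triangle a^c_{o(i)} ⨾ v_i ≈ a^b_i to S(a^c_{o(i)}) ⨾ v_i ≈ S(a^b_i).  Since S̄
-- keeps the width, the targets P_i and the subconditions, the remaining data
-- of m (o, v_i, the inner root shifters and m_i) is reused verbatim.  The
-- trivial root shifter is only defined when |b| = 0, and then m is empty.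
module Submission where

open import Defs
open import Data.Product using (Σ; _×_; _,_)
open import Data.Unit using (tt)
open import Data.Fin using (Fin)
open import Relation.Binary.PropositionalEquality using (refl; sym; trans)

module _ {D : SmallCategory} where
  open Presheaves D

  shift-preserves-triangle : ∀ {X Y P Q} (S : SourceShifter X Y)
                             (a : X ⇒ P) (v : P ⇒ Q) {a′ : X ⇒ Q} →
                             a ⨾ v ≈ a′ → shift S a ⨾ v ≈ shift S a′
  shift-preserves-triangle S a v triangle d x =
    trans (sym (shift-⨾ S a v d x)) (shift-cong S triangle d x)

  ≐-refl : ∀ t → t ≐ t
  ≐-refl (tuple _ _ _ m) = same (λ _ → refl) (λ _ → refl) (λ i → ≐-refl (m i))

  module _ {X Y : Presheaf} (S : SourceShifter X Y) where

    shiftAC : AC X → AC Y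
    shiftAC c = applyR (rshift S) c tt

    FMor-shift : ∀ {c b : AC X} → FMor c b → FMor (shiftAC c) (shiftAC b)
    FMor-shift {c} (fmor o v comm F def m) =
      fmor o v (λ i → shift-preserves-triangle S (arrAt c (o i)) (v i) (comm i)) F def m

    BMor-shift : ∀ {c b : AC X} → BMor c b → BMor (shiftAC c) (shiftAC b)
    BMor-shift {c} (bmor o v comm B def m) =
      bmor o v (λ i → shift-preserves-triangle S (arrAt c (o i)) (v i) (comm i)) B def m

    tupleF-FMor-shift : ∀ {c b : AC X} (m : FMor c b) → tupleF (FMor-shift m) ≐ tupleF m
    tupleF-FMor-shift m@(fmor _ _ _ _ _ _) = ≐-refl (tupleF m)

    tupleB-BMor-shift : ∀ {c b : AC X} (m : BMor c b) → tupleB (BMor-shift m) ≐ tupleB m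
    tupleB-BMor-shift m@(bmor _ _ _ _ _ _) = ≐-refl (tupleB m)

  ≐-empty : ∀ {o o′ v v′ m m′} → tuple 0 o v m ≐ tuple 0 o′ v′ m′
  ≐-empty = same (λ ()) (λ ()) (λ ())

  FMor-into-empty : ∀ {R R′} {c : AC R} {c′ : AC R′} {q q′} (m : FMor c′ (cond 0 q′)) →
                    Σ (FMor c (cond 0 q)) (λ m′ → tupleF m′ ≐ tupleF m)
  FMor-into-empty (fmor _ _ _ _ _ _) =
    fmor (λ ()) (λ ()) (λ ()) (λ ()) (λ ()) (λ ()) , ≐-empty

  BMor-into-empty : ∀ {R R′} {c : AC R} {c′ : AC R′} {q q′} (m : BMor c′ (cond 0 q′)) →
                    Σ (BMor c (cond 0 q)) (λ m′ → tupleB m′ ≐ tupleB m)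
  BMor-into-empty (bmor _ _ _ _ _ _) =
    bmor (λ ()) (λ ()) (λ ()) (λ ()) (λ ()) (λ ()) , ≐-empty

open Presheaves using (cond; rshift; rtriv)

lemma3 : (D : SmallCategory) →
         let open Presheaves D in
         ∀ {X Y : Presheaf} (c b : AC X) (𝒞 : RootShifter X Y)
           (dc : DefinedOn 𝒞 c) (db : DefinedOn 𝒞 b) →
         ((m : FMor c b) →
            Σ (FMor (applyR 𝒞 c dc) (applyR 𝒞 b db))
              (λ m′ → tupleF m′ ≐ tupleF m))
         ×
         ((m : BMor c b) →
            Σ (BMor (applyR 𝒞 c dc) (applyR 𝒞 b db))
              (λ m′ → tupleB m′ ≐ tupleB m))
lemma3 D c b (rshift S) _ _ =
  (λ m → FMor-shift S m , tupleF-FMor-shift S m) ,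
  (λ m → BMor-shift S m , tupleB-BMor-shift S m)
lemma3 D c (cond .0 q) rtriv _ refl =
  FMor-into-empty , BMor-into-empty
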